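{- Let $n,m$ be integers with $n\ge 5$ and $1\le m\le n-4$. Then $$\delta(n,m)\le\left\lceil\frac{n-1}{m}\right\rceil+\delta(n-1,m).$$
   Context: For integers $N\ge 2$ and $1\le m\le N-1$, let $G_m$ (in $S_N$) be the set of transpositions $(a,b)$ with $1\le a<b\le N$ and $b-a\le m$; for $\sigma\in S_N$ let $d({\bf 1},\sigma,m)$ be the minimum number of transpositions from $G_m$ whose product is $\sigma$, and let $\delta(N,m)=\max_{\sigma\in S_N}d({\bf 1},\sigma,m)$. Here $\delta(n-1,m)$ refers to this quantity for $S_{n-1}$. -}

module Defs where

open import Data.Nat using (ℕ; zero; suc; _+_; _≤_; _<_)
open import Data.Nat.DivMod using (_/_)
open import Data.Fin using (Fin; toℕ)
open import Data.Fin.Permutation using (Permutation′; id; _∘ₚ_; transpose; _≈_)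
open import Data.List using (List; []; _∷_; length)
open import Data.Product using (Σ; ∃; _×_)
open import Relation.Binary.PropositionalEquality using (_≡_)

-- An element of G_m in S_N: a transposition (a,b), a < b, b - a ≤ m.
-- Points of {1..N} are represented 0-indexed by Fin N (differences unaffected).
record Gen (N m : ℕ) : Set where
  constructor gen
  field
    a b   : Fin N
    a<b   : toℕ a < toℕ b
    b-a≤m : toℕ b ≤ toℕ a + m

genPerm : ∀ {N m} → Gen N m → Permutation′ N
genPerm (gen a b _ _) = transpose a b

prod : ∀ {N m} → List (Gen N m) → Permutation′ N
prod []       = id
prod (g ∷ w) = genPerm g ∘ₚ prod w

ProductOfLength : (N m : ℕ) → Permutation′ N → ℕ → Set
ProductOfLength N m σ k = Σ (List (Gen N m)) λ w → length w ≡ k × prod w ≈ σ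

IsDist : (N m : ℕ) → Permutation′ N → ℕ → Set
IsDist N m σ k = ProductOfLength N m σ k × (∀ j → ProductOfLength N m σ j → k ≤ j)

IsDelta : (N m : ℕ) → ℕ → Set
IsDelta N m D = (∃ λ σ → IsDist N m σ D) × (∀ σ k → IsDist N m σ k → k ≤ D)

-- ⌈ a / m ⌉ (m ≥ 1; value 0 for m = 0, never used)
ceilDiv : ℕ → ℕ → ℕ
ceilDiv a zero    = 0
ceilDiv a (suc k) = (a + k) / suc k

-- Hopping m points at a time, a word ρ of at most ⌈(n-1)/m⌉ generators sends the first point
-- to σ's image of it. Then σ ρ⁻¹ fixes the first point, so it is the lift of a permutation π of
-- the other n - 1 points, and a word for π of length d(1,π,m) ≤ δ(n-1,m), followed by ρ, is a
-- word for σ. Since the minimum d(1,π,m) exists only classically, the decidable goal is proved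
-- by double negation.
module Submission where

open import Defs
open import Data.Nat using (ℕ; zero; suc; _+_; _∸_; _≤_; _<_; z≤n; s≤s; _≤?_)
open import Data.Nat.Properties
open import Data.Nat.DivMod using (_/_; m/n≡1+[m∸n]/n; m≥n⇒m/n>0; /-monoˡ-≤)
open import Data.Nat.Induction using (<-rec)
open import Data.Fin using (Fin; toℕ; fromℕ<) renaming (zero to fz; suc to fs)
import Data.Fin as Fin
open import Data.Fin.Properties using (toℕ-fromℕ<; toℕ<n; fromℕ<-toℕ)
open import Data.Fin.Permutation
import Data.Fin.Permutation.Components as PC
open import Data.List using (List; []; _∷_; length; _++_; map)
open import Data.List.Properties using (length-++; length-map)
open import Data.Product using (Σ; ∃; _,_; proj₁; proj₂; _×_)
open import Data.Sum using (inj₁; inj₂)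
open import Relation.Binary.PropositionalEquality
open import Relation.Nullary using (¬_; yes; no)
open import Relation.Nullary.Decidable using (dec-true; decidable-stable)

prod-++ : ∀ {N m} (u v : List (Gen N m)) → prod (u ++ v) ≈ prod u ∘ₚ prod v
prod-++ []      v i = refl
prod-++ (g ∷ u) v i = prod-++ u v (genPerm g ⟨$⟩ʳ i)

liftGen : ∀ {N m} → Gen N m → Gen (suc N) m
liftGen (gen a b a<b b≤a+m) = gen (fs a) (fs b) (s≤s a<b) (s≤s b≤a+m)

prod-map-liftGen : ∀ {N m} (w : List (Gen N m)) → prod (map liftGen w) ≈ lift₀ (prod w)
prod-map-liftGen []                  i = sym (lift₀-id i)
prod-map-liftGen (gen a b _ _ ∷ w) i = begin
  prod (map liftGen w) ⟨$⟩ʳ (PC.transpose (fs a) (fs b) i) ≡⟨ prod-map-liftGen w _ ⟩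
  lift₀ (prod w) ⟨$⟩ʳ (PC.transpose (fs a) (fs b) i)       ≡⟨ cong (lift₀ (prod w) ⟨$⟩ʳ_) (lift₀-transpose a b i) ⟩
  lift₀ (prod w) ⟨$⟩ʳ (lift₀ (transpose a b) ⟨$⟩ʳ i)      ≡⟨ lift₀-comp (transpose a b) (prod w) i ⟩
  lift₀ (transpose a b ∘ₚ prod w) ⟨$⟩ʳ i                  ∎
  where open ≡-Reasoning

transpose-first : ∀ {n} (a b : Fin n) → transpose a b ⟨$⟩ʳ a ≡ b
transpose-first a b rewrite dec-true (a Fin.≟ a) refl = refl

ceilDiv-pos : ∀ {x} k → 1 ≤ x → 1 ≤ ceilDiv x (suc k)
ceilDiv-pos {suc x} k _ = m≥n⇒m/n>0 (s≤s (m≤n+m k x))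

ceilDiv-step : ∀ {x} k → suc k ≤ x → ceilDiv x (suc k) ≡ suc (ceilDiv (x ∸ suc k) (suc k))
ceilDiv-step {x} k k<x = begin
  (x + k) / suc k                ≡⟨ m/n≡1+[m∸n]/n (≤-trans k<x (m≤m+n x k)) ⟩
  suc ((x + k ∸ suc k) / suc k)  ≡⟨ cong (λ t → suc (t / suc k)) (+-∸-comm k k<x) ⟩
  suc ((x ∸ suc k + k) / suc k)  ∎
  where open ≡-Reasoning

ceilDiv-monoˡ-≤ : ∀ {x y} k → x ≤ y → ceilDiv x (suc k) ≤ ceilDiv y (suc k)
ceilDiv-monoˡ-≤ k x≤y = /-monoˡ-≤ (suc k) (+-monoˡ-≤ k x≤y)

hop : ∀ {N m y x} (y<N : y < N) (x<N : x < N) → y < x → x ≤ y + m → Gen N m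
hop {m = m} y<N x<N y<x x≤y+m = gen (fromℕ< y<N) (fromℕ< x<N) a<b b≤a+m
  where
  a<b : toℕ (fromℕ< y<N) < toℕ (fromℕ< x<N)
  a<b rewrite toℕ-fromℕ< y<N | toℕ-fromℕ< x<N = y<x
  b≤a+m : toℕ (fromℕ< x<N) ≤ toℕ (fromℕ< y<N) + m
  b≤a+m rewrite toℕ-fromℕ< y<N | toℕ-fromℕ< x<N = x≤y+m

reach : ∀ {M} k x (x<N : x < suc M) →
  Σ (List (Gen (suc M) (suc k))) λ w → length w ≤ ceilDiv x (suc k) × prod w ⟨$⟩ʳ fz ≡ fromℕ< x<N
reach {M} k = <-rec Reach step
  where
  Reach : ℕ → Set
  Reach x = (x<N : x < suc M) →
    Σ (List (Gen (suc M) (suc k))) λ w → length w ≤ ceilDiv x (suc k) × prod w ⟨$⟩ʳ fz ≡ fromℕ< x<N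

  step : ∀ x → (∀ {y} → y < x → Reach y) → Reach x
  step zero      _   _   = [] , z≤n , refl
  step x@(suc _) rec x<N with x ≤? suc k
  ... | yes x≤m = hop (s≤s z≤n) x<N (s≤s z≤n) x≤m ∷ [] , ceilDiv-pos k (s≤s z≤n)
                , transpose-first fz (fromℕ< x<N)
  ... | no x≰m  = w ++ hop y<N x<N y<x x≤y+m ∷ [] , length-bound , endpoint
    where
    m≤x = <⇒≤ (≰⇒> x≰m)
    y = x ∸ suc k
    y<x : y < x
    y<x = ∸-monoʳ-< (s≤s z≤n) m≤x
    x≤y+m : x ≤ y + suc k
    x≤y+m = ≤-reflexive (sym (m∸n+n≡m m≤x))
    y<N = <-trans y<x x<N
    previous = rec y<x y<N
    w = proj₁ previous
    length-bound : length (w ++ hop y<N x<N y<x x≤y+m ∷ []) ≤ ceilDiv x (suc k)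
    length-bound = begin
      length (w ++ _ ∷ [])       ≡⟨ length-++ w ⟩
      length w + 1               ≡⟨ +-comm (length w) 1 ⟩
      suc (length w)             ≤⟨ s≤s (proj₁ (proj₂ previous)) ⟩
      suc (ceilDiv y (suc k))    ≡⟨ sym (ceilDiv-step k m≤x) ⟩
      ceilDiv x (suc k)          ∎
      where open ≤-Reasoning
    endpoint : prod (w ++ hop y<N x<N y<x x≤y+m ∷ []) ⟨$⟩ʳ fz ≡ fromℕ< x<N
    endpoint = begin
      prod (w ++ _ ∷ []) ⟨$⟩ʳ fz                          ≡⟨ prod-++ w _ fz ⟩
      PC.transpose (fromℕ< y<N) (fromℕ< x<N) (prod w ⟨$⟩ʳ fz) ≡⟨ cong (PC.transpose _ _) (proj₂ (proj₂ previous)) ⟩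
      PC.transpose (fromℕ< y<N) (fromℕ< x<N) (fromℕ< y<N) ≡⟨ transpose-first (fromℕ< y<N) (fromℕ< x<N) ⟩
      fromℕ< x<N                                          ∎
      where open ≡-Reasoning

descend : ∀ {M} k (σ : Permutation′ (suc M)) → Σ (Permutation′ M) λ π →
  ∀ {j} → ProductOfLength M (suc k) π j →
  ∃ λ i → i ≤ j + ceilDiv M (suc k) × ProductOfLength (suc M) (suc k) σ i
descend {M} k σ = π , extend
  where
  x<N = toℕ<n (σ ⟨$⟩ʳ fz)
  path = reach k (toℕ (σ ⟨$⟩ʳ fz)) x<N
  w₁ = proj₁ path
  ρ = prod w₁
  ρ0≡σ0 : ρ ⟨$⟩ʳ fz ≡ σ ⟨$⟩ʳ fz
  ρ0≡σ0 = trans (proj₂ (proj₂ path)) (fromℕ<-toℕ _ x<N)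
  τ = σ ∘ₚ flip ρ
  τ-fixes-0 : τ ⟨$⟩ʳ fz ≡ fz
  τ-fixes-0 = trans (cong (ρ ⟨$⟩ˡ_) (sym ρ0≡σ0)) (inverseˡ ρ)
  π = remove fz τ
  |w₁|≤ : length w₁ ≤ ceilDiv M (suc k)
  |w₁|≤ = ≤-trans (proj₁ (proj₂ path)) (ceilDiv-monoˡ-≤ k (≤-pred x<N))

  extend : ∀ {j} → ProductOfLength M (suc k) π j →
    ∃ λ i → i ≤ j + ceilDiv M (suc k) × ProductOfLength (suc M) (suc k) σ i
  extend {j} (w , |w|≡j , w≈π) = length W , length-bound , W , refl , W≈σ
    where
    W = map liftGen w ++ w₁
    length-bound : length W ≤ j + ceilDiv M (suc k)
    length-bound = begin
      length W                         ≡⟨ length-++ (map liftGen w) ⟩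
      length (map liftGen w) + length w₁ ≡⟨ cong (_+ length w₁) (trans (length-map liftGen w) |w|≡j) ⟩
      j + length w₁                    ≤⟨ +-monoʳ-≤ j |w₁|≤ ⟩
      j + ceilDiv M (suc k)            ∎
      where open ≤-Reasoning
    W≈σ : prod W ≈ σ
    W≈σ i = begin
      prod W ⟨$⟩ʳ i                      ≡⟨ prod-++ (map liftGen w) w₁ i ⟩
      ρ ⟨$⟩ʳ (prod (map liftGen w) ⟨$⟩ʳ i) ≡⟨ cong (ρ ⟨$⟩ʳ_) (prod-map-liftGen w i) ⟩
      ρ ⟨$⟩ʳ (lift₀ (prod w) ⟨$⟩ʳ i)       ≡⟨ cong (ρ ⟨$⟩ʳ_) (lift₀-cong (prod w) π w≈π i) ⟩
      ρ ⟨$⟩ʳ (lift₀ π ⟨$⟩ʳ i)              ≡⟨ cong (ρ ⟨$⟩ʳ_) (lift₀-remove τ τ-fixes-0 i) ⟩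
      ρ ⟨$⟩ʳ (ρ ⟨$⟩ˡ (σ ⟨$⟩ʳ i))           ≡⟨ inverseʳ ρ ⟩
      σ ⟨$⟩ʳ i                           ∎
      where open ≡-Reasoning

generated : ∀ k N (σ : Permutation′ N) → ∃ (ProductOfLength N (suc k) σ)
generated k zero    σ = 0 , [] , refl , λ ()
generated k (suc M) σ with descend k σ
... | π , extend with generated k M π
...   | _ , πⱼ with extend πⱼ
...     | i , _ , σᵢ = i , σᵢ

module _ {P : ℕ → Set} where

  HasMinimum : Set
  HasMinimum = ∃ λ n → P n × (∀ j → P j → n ≤ j)

  none-below : ¬ HasMinimum → ∀ n {j} → j < n → ¬ P j
  none-below no-min (suc n) {j} j<1+n Pj with m<1+n⇒m<n∨m≡n j<1+n
  ... | inj₁ j<n  = none-below no-min n j<n Pj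
  ... | inj₂ refl = no-min (j , Pj , λ i Pi → ≮⇒≥ (λ i<j → none-below no-min j i<j Pi))

  ¬¬-minimum : ∀ {n} → P n → ¬ ¬ HasMinimum
  ¬¬-minimum {n} Pn no-min = none-below no-min (suc n) ≤-refl Pn

proposition2p7 : (n m : ℕ) → 5 ≤ n → 1 ≤ m → m ≤ n ∸ 4 →
    (D D′ : ℕ) → IsDelta n m D → IsDelta (n ∸ 1) m D′ →
    D ≤ ceilDiv (n ∸ 1) m + D′
proposition2p7 (suc M) (suc k) _ _ _ D D′ ((σ , _ , σ-minimal) , _) (_ , D′-maximal) =
  decidable-stable (D ≤? ceilDiv M (suc k) + D′) λ D≰ →
    ¬¬-minimum (proj₂ (generated k M π)) λ (j , π-dist) → D≰ (bound π-dist)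
  where
  open ≤-Reasoning
  descent = descend k σ
  π = proj₁ descent
  bound : ∀ {j} → IsDist M (suc k) π j → D ≤ ceilDiv M (suc k) + D′
  bound {j} π-dist@(πⱼ , _) with proj₂ descent πⱼ
  ... | i , i≤ , σᵢ = begin
    D                     ≤⟨ σ-minimal i σᵢ ⟩
    i                     ≤⟨ i≤ ⟩
    j + ceilDiv M (suc k) ≤⟨ +-monoˡ-≤ _ (D′-maximal π j π-dist) ⟩
    D′ + ceilDiv M (suc k) ≡⟨ +-comm D′ _ ⟩
    ceilDiv M (suc k) + D′ ∎
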